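{- Consider peg solitaire on Wiegleb's 45-hole board. Start with a man in every hole except g5. Then there is a legal sequence of moves that ends with a single man at d2, in which the last move is the 16-jump sweep by one man along the path d2-f2-f4-h4-h6-f6-f8-d8-d6-d4-f4-f6-d6-b6-b4-d4-d2.
   Context: Wiegleb's board has columns labelled a–i and rows numbered 1–9. Its holes are all holes in columns d, e, f (rows 1–9) together with all holes in rows 4, 5, 6 (columns a–i), 45 holes in total. Peg solitaire rules: each hole is either empty or holds one man. A jump takes a man from a hole X over an orthogonally adjacent occupied hole Y into the empty hole Z immediately beyond Y on the same line; the man at Y is removed. A jump is written X-Z. A move is a sequence of one or more consecutive jumps made by the same man, written X-Z-W-...; a move with k jumps is a k-sweep. -}

module Defs where

open import Data.Bool using (Bool; true; false; _∧_; _∨_; not; if_then_else_)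
open import Data.Nat using (ℕ; zero; suc; _+_; _*_; _≡ᵇ_; _≤ᵇ_)
open import Data.Vec using (Vec; []; _∷_; tabulate)
open import Data.Fin using (Fin; toℕ)
open import Data.List using (List; []; _∷_)
open import Data.Maybe using (Maybe; just; nothing; _>>=_)
open import Data.Product using (_×_; _,_)

-- Coordinates: (column , row), both 0-based.
-- Column a ↦ 0, …, i ↦ 8;  row 1 ↦ 0, …, row 9 ↦ 8.
Coord : Set
Coord = ℕ × ℕ

data Col : Set where
  a b c d e f g h i : Col

colIndex : Col → ℕ
colIndex a = 0
colIndex b = 1
colIndex c = 2
colIndex d = 3
colIndex e = 4
colIndex f = 5
colIndex g = 6
colIndex h = 7
colIndex i = 8

-- sq x n is the hole with column letter x and row number n (1-based, as on the board)
sq : Col → ℕ → Coord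
sq x zero    = (colIndex x , 0)   -- row 0 does not exist on the board; never used
sq x (suc n) = (colIndex x , n)

-- Wiegleb's 45-hole board: columns d,e,f (all rows) and rows 4,5,6 (all columns)
inRange : ℕ → ℕ → ℕ → Bool
inRange lo hi n = (lo ≤ᵇ n) ∧ (n ≤ᵇ hi)

isHole : Coord → Bool
isHole (x , y) = (inRange 3 5 x ∧ inRange 0 8 y) ∨ (inRange 3 5 y ∧ inRange 0 8 x)

eqCoord : Coord → Coord → Bool
eqCoord (x , y) (x' , y') = (x ≡ᵇ x') ∧ (y ≡ᵇ y')

-- A position: a 9×9 array of Bools (row-major, indexed [row][column]); true = a man.
-- Cells that are not holes of the board are always false.
Position : Set
Position = Vec (Vec Bool 9) 9

fromPred : (Coord → Bool) → Position
fromPred p = tabulate (λ r → tabulate (λ col →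
  isHole (toℕ col , toℕ r) ∧ p (toℕ col , toℕ r)))

-- lookup / update with ℕ indices (out of range: false / no change)
lookupℕ : {n : ℕ} → Vec Bool n → ℕ → Bool
lookupℕ []       _       = false
lookupℕ (v ∷ vs) zero    = v
lookupℕ (v ∷ vs) (suc k) = lookupℕ vs k

updateℕ : {A : Set} {n : ℕ} → Vec A n → ℕ → (A → A) → Vec A n
updateℕ []       _       _ = []
updateℕ (v ∷ vs) zero    u = u v ∷ vs
updateℕ (v ∷ vs) (suc k) u = v ∷ updateℕ vs k u

get : Position → Coord → Bool
get p (x , y) = go p y
  where
  go : {n : ℕ} → Vec (Vec Bool 9) n → ℕ → Bool
  go []       _       = false
  go (r ∷ rs) zero    = lookupℕ r x
  go (r ∷ rs) (suc k) = go rs k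

set : Position → Coord → Bool → Position
set p (x , y) v = updateℕ p y (λ row → updateℕ row x (λ _ → v))

between : Coord → Coord → Maybe Coord
between (x₁ , y₁) (x₂ , y₂) =
  if (x₁ ≡ᵇ x₂) ∧ (suc (suc y₁) ≡ᵇ y₂) then just (x₁ , suc y₁) else
  if (x₁ ≡ᵇ x₂) ∧ (suc (suc y₂) ≡ᵇ y₁) then just (x₁ , suc y₂) else
  if (y₁ ≡ᵇ y₂) ∧ (suc (suc x₁) ≡ᵇ x₂) then just (suc x₁ , y₁) else
  if (y₁ ≡ᵇ y₂) ∧ (suc (suc x₂) ≡ᵇ x₁) then just (suc x₂ , y₁) else
  nothing

jump : Position → Coord → Coord → Maybe Position
jump p X Z with between X Z
... | nothing = nothing
... | just Y  =
  if isHole X ∧ isHole Y ∧ isHole Z ∧ get p X ∧ get p Y ∧ not (get p Z)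
  then just (set (set (set p X false) Y false) Z true)
  else nothing

move : Position → List Coord → Maybe Position
move p []            = nothing
move p (X ∷ [])      = nothing
move p (X ∷ Z ∷ [])  = jump p X Z
move p (X ∷ Z ∷ W ∷ rest) = jump p X Z >>= λ q → move q (Z ∷ W ∷ rest)

play : Position → List (List Coord) → Maybe Position
play p []         = just p
play p (m ∷ ms)   = move p m >>= λ q → play q ms

initial : Position
initial = fromPred (λ X → not (eqCoord X (sq g 5)))

final : Position
final = fromPred (λ X → eqCoord X (sq d 2))

lastMove : List Coord
lastMove = sq d 2 ∷ sq f 2 ∷ sq f 4 ∷ sq h 4 ∷ sq h 6 ∷ sq f 6 ∷ sq f 8 ∷ sq d 8 ∷
           sq d 6 ∷ sq d 4 ∷ sq f 4 ∷ sq f 6 ∷ sq d 6 ∷ sq b 6 ∷ sq b 4 ∷ sq d 4 ∷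
           sq d 2 ∷ []

{-# OPTIONS --safe #-}
module Submission where

open import Defs
open import Data.List using (List; _∷_; []; _++_)
open import Data.Bool.ListAction using (any)
open import Data.Maybe using (just; nothing; _>>=_)
open import Data.Product using (∃-syntax; _,_)
open import Relation.Binary.PropositionalEquality using (_≡_; refl; cong; module ≡-Reasoning)
open ≡-Reasoning

-- Before the 16-sweep the only men left are the sweeper at d2 and the sixteen men it jumps
-- over; 27 single jumps from the start clear every other hole.  Both halves are checked by
-- evaluation.

play-++ : ∀ p ms ns → play p (ms ++ ns) ≡ (play p ms >>= λ q → play q ns)
play-++ p []       ns = refl
play-++ p (m ∷ ms) ns with move p m
... | nothing = refl
... | just q  = play-++ q ms ns

hop : Coord → Coord → List Coord
hop X Z = X ∷ Z ∷ []

preparation : List (List Coord)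
preparation =
    hop (sq i 5) (sq g 5) ∷ hop (sq f 5) (sq h 5) ∷ hop (sq d 5) (sq f 5)
  ∷ hop (sq d 3) (sq d 5) ∷ hop (sq b 4) (sq d 4) ∷ hop (sq c 6) (sq c 4)
  ∷ hop (sq a 6) (sq c 6) ∷ hop (sq d 6) (sq b 6) ∷ hop (sq d 8) (sq d 6)
  ∷ hop (sq f 7) (sq d 7) ∷ hop (sq e 9) (sq e 7) ∷ hop (sq e 6) (sq e 8)
  ∷ hop (sq g 6) (sq e 6) ∷ hop (sq f 3) (sq d 3) ∷ hop (sq i 6) (sq g 6)
  ∷ hop (sq f 1) (sq f 3) ∷ hop (sq f 4) (sq f 2) ∷ hop (sq d 4) (sq f 4)
  ∷ hop (sq a 4) (sq a 6) ∷ hop (sq a 6) (sq c 6) ∷ hop (sq g 4) (sq e 4)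
  ∷ hop (sq i 4) (sq g 4) ∷ hop (sq f 9) (sq f 7) ∷ hop (sq d 1) (sq f 1)
  ∷ hop (sq d 6) (sq d 8) ∷ hop (sq f 1) (sq f 3) ∷ hop (sq d 9) (sq d 7)
  ∷ []

-- d2, followed by the holes jumped over by lastMove, in order.
sweepReady : Position
sweepReady = fromPred (λ X → any (eqCoord X) (
    sq d 2
  ∷ sq e 2 ∷ sq f 3 ∷ sq g 4 ∷ sq h 5 ∷ sq g 6 ∷ sq f 7 ∷ sq e 8 ∷ sq d 7
  ∷ sq d 5 ∷ sq e 4 ∷ sq f 5 ∷ sq e 6 ∷ sq c 6 ∷ sq b 5 ∷ sq c 4 ∷ sq d 3
  ∷ []))

play-preparation : play initial preparation ≡ just sweepReady
play-preparation = refl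

move-lastMove : move sweepReady lastMove ≡ just final
move-lastMove = refl

mainTheorem1 : ∃[ ms ] play initial (ms ++ (lastMove ∷ [])) ≡ just final
mainTheorem1 = preparation , (begin
  play initial (preparation ++ lastMove ∷ [])
    ≡⟨ play-++ initial preparation (lastMove ∷ []) ⟩
  (play initial preparation >>= λ q → play q (lastMove ∷ []))
    ≡⟨ cong (_>>= λ q → play q (lastMove ∷ [])) play-preparation ⟩
  (move sweepReady lastMove >>= just)
    ≡⟨ cong (_>>= just) move-lastMove ⟩
  just final ∎)
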